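{- Let $G$ be a connected graph with a set of cousins $C=\{\{v_1,v_2\},\{v_3,v_4\}\}$ such that $v_1v_2\notin E(G)$ and $v_3v_4\notin E(G)$. Then $d_{G+v_1v_2}(u,v)=d_G(u,v)=d_{G+v_3v_4}(u,v)$ for all $u\in U(C)$ and all $v\in V(G)$.
   Context: All graphs are finite, simple, undirected; $d_H(u,v)$ is the length of a shortest $u,v$-path in $H$ and $G+xy$ denotes $G$ with edge $xy$ added. Let $G$ be a connected graph of order at least five with distinct vertices $v_1,v_2,v_3,v_4$, let $C=\{\{v_1,v_2\},\{v_3,v_4\}\}$ and $U(C)=V(G)\setminus\{v_1,v_2,v_3,v_4\}$. Then $C$ is a set of cousins in $G$ if (1) for all $u\in U(C)$, $d_G(u,v_1)=d_G(u,v_2)$ and $d_G(u,v_3)=d_G(u,v_4)$; and (2) $\sum_{u\in U(C)}d_G(u,v_1)=\sum_{u\in U(C)}d_G(u,v_3)$. -}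

module Defs where

open import Data.Nat using (ℕ; zero; suc; _≤_)
open import Data.Fin using (Fin; _≟_)
open import Data.Bool using (Bool; true; false; _∨_; _∧_)
open import Data.List using (List; map; filter; allFin)
open import Data.Nat.ListAction using (sum)
open import Data.Product using (_×_; ∃)
open import Relation.Nullary using (¬_; _because_)
open import Relation.Nullary.Decidable using (⌊_⌋)
open import Relation.Binary.PropositionalEquality using (_≡_; _≢_)
open import Relation.Unary using (Pred)
import Relation.Nullary.Decidable as D

Graph : ℕ → Set
Graph n = Fin n → Fin n → Bool

IsSimple : ∀ {n} → Graph n → Set
IsSimple {n} G = (∀ (x y : Fin n) → G x y ≡ G y x) × (∀ (x : Fin n) → G x x ≡ false)

Adj : ∀ {n} → Graph n → Fin n → Fin n → Set
Adj G x y = G x y ≡ true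

addEdge : ∀ {n} → Graph n → Fin n → Fin n → Graph n
addEdge G a b x y = G x y ∨ ((⌊ x ≟ a ⌋ ∧ ⌊ y ≟ b ⌋) ∨ (⌊ x ≟ b ⌋ ∧ ⌊ y ≟ a ⌋))

data Walk {n} (G : Graph n) : Fin n → Fin n → ℕ → Set where
  nil  : ∀ {u} → Walk G u u 0
  cons : ∀ {u w v k} → Adj G u w → Walk G w v k → Walk G u v (suc k)

Dist : ∀ {n} → Graph n → Fin n → Fin n → ℕ → Set
Dist G u v k = Walk G u v k × (∀ m → Walk G u v m → k ≤ m)

Connected : ∀ {n} → Graph n → Set
Connected {n} G = ∀ (u v : Fin n) → ∃ λ k → Walk G u v k

InU : ∀ {n} → Fin n → Fin n → Fin n → Fin n → Fin n → Set
InU v₁ v₂ v₃ v₄ u = u ≢ v₁ × u ≢ v₂ × u ≢ v₃ × u ≢ v₄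

inU? : ∀ {n} → Fin n → Fin n → Fin n → Fin n → Fin n → Bool
inU? v₁ v₂ v₃ v₄ u =
  D.isNo (u ≟ v₁) ∧ D.isNo (u ≟ v₂) ∧ D.isNo (u ≟ v₃) ∧ D.isNo (u ≟ v₄)

Ulist : ∀ {n} → Fin n → Fin n → Fin n → Fin n → List (Fin n)
Ulist {n} v₁ v₂ v₃ v₄ = filter (λ u → D.T? (inU? v₁ v₂ v₃ v₄ u)) (allFin n)

-- Distances are given relationally (Dist), so the sums in (2) are taken over
-- functions d₁ d₃ that are certified to be the distance functions to v₁, v₃ on U(C).
record Cousins {n} (G : Graph n) (v₁ v₂ v₃ v₄ : Fin n) : Set where
  field
    distinct : v₁ ≢ v₂ × v₁ ≢ v₃ × v₁ ≢ v₄ × v₂ ≢ v₃ × v₂ ≢ v₄ × v₃ ≢ v₄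
    cond1 : ∀ u → InU v₁ v₂ v₃ v₄ u → ∀ k →
              (Dist G u v₁ k → Dist G u v₂ k) × (Dist G u v₂ k → Dist G u v₁ k) ×
              (Dist G u v₃ k → Dist G u v₄ k) × (Dist G u v₄ k → Dist G u v₃ k)
    cond2 : ∃ λ (d₁ : Fin n → ℕ) → ∃ λ (d₃ : Fin n → ℕ) →
              (∀ u → InU v₁ v₂ v₃ v₄ u → Dist G u v₁ (d₁ u) × Dist G u v₃ (d₃ u)) ×
              (sum (map d₁ (Ulist v₁ v₂ v₃ v₄)) ≡ sum (map d₃ (Ulist v₁ v₂ v₃ v₄)))

-- Adding an edge ab changes no distance from u as long as d(u,a) and d(u,b)
-- differ by at most one: a walk from u that uses the new edge can trade the
-- part up to it for a shortest u,b-walk (or u,a-walk) in G, which is at most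
-- as long.  Condition (1) for cousins makes d(u,v₁) = d(u,v₂) and
-- d(u,v₃) = d(u,v₄) for every u ∈ U(C).
module Submission where

open import Defs
open import Data.Nat using (ℕ; _≤_; _+_; suc; s≤s)
open import Data.Nat.Properties
  using (≤-trans; ≤-antisym; ≤-reflexive; n≤1+n; +-suc; +-identityʳ; +-monoˡ-≤)
open import Data.Fin using (Fin; _≟_)
open import Data.Bool using (true; false; _∨_)
open import Data.Product using (_×_; _,_; proj₁; proj₂; ∃)
open import Data.Sum using (_⊎_; inj₁; inj₂)
open import Relation.Nullary using (yes; no)
open import Relation.Binary.PropositionalEquality using (_≡_; refl; sym; cong; subst)

Walk-snoc : ∀ {n} {G : Graph n} {x y z k} → Walk G x y k → Adj G y z → Walk G x z (suc k)
Walk-snoc nil        e = cons e nil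
Walk-snoc (cons d W) e = cons d (Walk-snoc W e)

Walk-map : ∀ {n} {G H : Graph n} → (∀ {x y} → Adj G x y → Adj H x y) →
           ∀ {x y k} → Walk G x y k → Walk H x y k
Walk-map f nil        = nil
Walk-map f (cons e W) = cons (f e) (Walk-map f W)

module _ {n} {G : Graph n} {a b : Fin n} where

  Adj-addEdge : ∀ {x y} → Adj G x y → Adj (addEdge G a b) x y
  Adj-addEdge e = cong (_∨ _) e

  addEdge-Adj-cases : ∀ {x y} → Adj (addEdge G a b) x y →
    Adj G x y ⊎ (x ≡ a × y ≡ b) ⊎ (x ≡ b × y ≡ a)
  addEdge-Adj-cases {x} {y} with G x y | x ≟ a | y ≟ b | x ≟ b | y ≟ a
  ... | true  | _     | _     | _     | _     = λ _ → inj₁ refl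
  ... | false | yes p | yes q | _     | _     = λ _ → inj₂ (inj₁ (p , q))
  ... | false | _     | _     | yes p | yes q = λ _ → inj₂ (inj₂ (p , q))
  ... | false | no _  | _     | no _  | _     = λ ()
  ... | false | no _  | _     | yes _ | no _  = λ ()
  ... | false | yes _ | no _  | no _  | _     = λ ()
  ... | false | yes _ | no _  | yes _ | no _  = λ ()

Dist-⇔-of-shortening : ∀ {n} {G H : Graph n} {u v : Fin n} →
  (∀ {k} → Walk G u v k → Walk H u v k) →
  (∀ {m} → Walk H u v m → ∃ λ m′ → m′ ≤ m × Walk G u v m′) →
  ∀ {k} → (Dist G u v k → Dist H u v k) × (Dist H u v k → Dist G u v k)
Dist-⇔-of-shortening embed shorten = toH , toG
  where
  toH : ∀ {k} → Dist _ _ _ k → Dist _ _ _ k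
  toH (W , minimal) = embed W , λ m W′ →
    let (m′ , m′≤m , V) = shorten W′ in ≤-trans (minimal m′ V) m′≤m
  toG : ∀ {k} → Dist _ _ _ k → Dist _ _ _ k
  toG (W , minimal) with shorten W
  ... | k′ , k′≤k , V =
    subst (Walk _ _ _) (≤-antisym k′≤k (minimal k′ (embed V))) V ,
    λ m V′ → minimal m (embed V′)

module _ {n} (G : Graph n) {u a b : Fin n} {dₐ d_b : ℕ}
         (u-a : Dist G u a dₐ) (u-b : Dist G u b d_b)
         (dₐ≤1+d_b : dₐ ≤ suc d_b) (d_b≤1+dₐ : d_b ≤ suc dₐ) where

  private
    G+ab = addEdge G a b

    step : ∀ {m′} p m → m′ ≤ suc p + m → m′ ≤ p + suc m
    step {m′} p m = subst (m′ ≤_) (sym (+-suc p m))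

  -- P is the already shortened prefix from u; W is the rest of the walk in G + ab.
  addEdge-shorten : ∀ {x v p m} → Walk G u x p → Walk G+ab x v m →
    ∃ λ m′ → m′ ≤ p + m × Walk G u v m′
  addEdge-shorten {p = p} P nil = p , ≤-reflexive (sym (+-identityʳ p)) , P
  addEdge-shorten {p = p} {suc m} P (cons e W) with addEdge-Adj-cases {G = G} {a} {b} e
  ... | inj₁ e∈G =
    let (m′ , le , V) = addEdge-shorten (Walk-snoc P e∈G) W in m′ , step p m le , V
  ... | inj₂ (inj₁ (refl , refl)) =
    let (m′ , le , V) = addEdge-shorten (proj₁ u-b) W
    in m′ , step p m (≤-trans le (+-monoˡ-≤ m (≤-trans d_b≤1+dₐ (s≤s (proj₂ u-a p P))))) , V
  ... | inj₂ (inj₂ (refl , refl)) =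
    let (m′ , le , V) = addEdge-shorten (proj₁ u-a) W
    in m′ , step p m (≤-trans le (+-monoˡ-≤ m (≤-trans dₐ≤1+d_b (s≤s (proj₂ u-b p P))))) , V

  addEdge-Dist-⇔ : ∀ v k → (Dist G u v k → Dist G+ab u v k) × (Dist G+ab u v k → Dist G u v k)
  addEdge-Dist-⇔ v k = Dist-⇔-of-shortening (Walk-map (Adj-addEdge {G = G} {a} {b})) (addEdge-shorten nil)

addEdge-Dist-⇔-equidistant : ∀ {n} (G : Graph n) {u a b : Fin n} {d : ℕ} →
  Dist G u a d → Dist G u b d →
  ∀ v k → (Dist G u v k → Dist (addEdge G a b) u v k) × (Dist (addEdge G a b) u v k → Dist G u v k)
addEdge-Dist-⇔-equidistant G {d = d} u-a u-b = addEdge-Dist-⇔ G u-a u-b (n≤1+n d) (n≤1+n d)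

lemma3p7 : ∀ {n} (G : Graph n) → IsSimple G → Connected G → 5 ≤ n →
    (v₁ v₂ v₃ v₄ : Fin n) → Cousins G v₁ v₂ v₃ v₄ →
    G v₁ v₂ ≡ false → G v₃ v₄ ≡ false →
    ∀ u → InU v₁ v₂ v₃ v₄ u → ∀ (v : Fin n) (k : ℕ) →
      (Dist G u v k → Dist (addEdge G v₁ v₂) u v k × Dist (addEdge G v₃ v₄) u v k) ×
      (Dist (addEdge G v₁ v₂) u v k → Dist G u v k) ×
      (Dist (addEdge G v₃ v₄) u v k → Dist G u v k)
lemma3p7 G _ _ _ v₁ v₂ v₃ v₄ C _ _ u u∈U v k =
  (λ d → proj₁ via₁₂ d , proj₁ via₃₄ d) , proj₂ via₁₂ , proj₂ via₃₄
  where
  open Cousins C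
  u-v₁ : Dist G u v₁ (proj₁ cond2 u)
  u-v₁ = proj₁ (proj₁ (proj₂ (proj₂ cond2)) u u∈U)
  u-v₃ : Dist G u v₃ (proj₁ (proj₂ cond2) u)
  u-v₃ = proj₂ (proj₁ (proj₂ (proj₂ cond2)) u u∈U)
  via₁₂ : (Dist G u v k → Dist (addEdge G v₁ v₂) u v k) × (Dist (addEdge G v₁ v₂) u v k → Dist G u v k)
  via₁₂ = addEdge-Dist-⇔-equidistant G u-v₁ (proj₁ (cond1 u u∈U _) u-v₁) v k
  via₃₄ : (Dist G u v k → Dist (addEdge G v₃ v₄) u v k) × (Dist (addEdge G v₃ v₄) u v k → Dist G u v k)
  via₃₄ = addEdge-Dist-⇔-equidistant G u-v₃ (proj₁ (proj₂ (proj₂ (cond1 u u∈U _))) u-v₃) v k
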